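{- Let $\mathcal{V}$ be a finite set and $\mathcal{F}=\{X_1,\dots,X_m\}$ a family of subsets of $\mathcal{V}$. Let $BM$ be the boolean matrix whose rows correspond to the sets of $\mathcal{F}$ listed in the order $LF$, whose columns correspond to the elements of $\mathcal{V}$ arranged so that the columns are sorted in increasing lexicographic order, and with $BM[i,j]=1$ iff the $j$-th element belongs to the $i$-th set. For $X\in\mathcal{F}$, let $\mathrm{left}(X)$ (resp. $\mathrm{right}(X)$) be the index of the column containing the leftmost (resp. rightmost) $1$ in the row of $X$. Let $X,Y\in\mathcal{F}$ be such that $Y$ overlaps $X$, and let $r_Y$ be the row of $Y$ in $BM$. Then there exists a row $t$ that is higher than or equal to $r_Y$ (i.e. $t\le r_Y$) such that $BM[t,\mathrm{left}(X)]=0$ and $BM[t,\mathrm{right}(X)]=1$.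
   Context: Two sets $A,B$ overlap if $A\cap B\neq\emptyset$, $A\setminus B\neq\emptyset$ and $B\setminus A\neq\emptyset$. $LF$ is the list of all sets of $\mathcal{F}$ sorted in decreasing order of size, sets of equal size being ordered in an arbitrary but fixed way. Rows of $BM$ are numbered $1,2,\dots$ from top to bottom in $LF$ order; a row $t$ is "higher" than a row $s$ if $t<s$. A column is read as the $0/1$ word of its entries from the top row to the bottom row, and lexicographic order uses $0<1$; "increasing lexicographic order" means column $j$ is lexicographically $\le$ column $j'$ whenever $j<j'$ (equal columns in any fixed order). -}

module Defs where

open import Data.Nat using (ℕ)
open import Data.Bool using (Bool; true; false)
open import Data.Fin using (Fin; _<_; _≤_)
open import Data.Fin.Subset using (∣_∣)
open import Data.Vec using (tabulate)
open import Data.Sum using (_⊎_)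
open import Data.Product using (Σ; _×_; ∃)
open import Relation.Binary.PropositionalEquality using (_≡_; _≢_)
open import Relation.Nullary using (¬_)

-- A boolean matrix with m rows (sets of F) and n columns (elements of V):
-- BM i j ≡ true iff the j-th element belongs to the i-th set.
BoolMatrix : ℕ → ℕ → Set
BoolMatrix m n = Fin m → Fin n → Bool

rowSize : ∀ {m n} → BoolMatrix m n → Fin m → ℕ
rowSize BM i = ∣ tabulate (BM i) ∣

-- rows are listed in decreasing order of size (order LF; ties arbitrary)
RowsInLF : ∀ {m n} → BoolMatrix m n → Set
RowsInLF BM = ∀ i i' → i < i' → rowSize BM i' Data.Nat.≤ rowSize BM i

-- the rows represent pairwise distinct sets (F is a family of sets)
RowsDistinct : ∀ {m n} → BoolMatrix m n → Set
RowsDistinct BM = ∀ i i' → i ≢ i' → ∃ λ j → BM i j ≢ BM i' j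

_≤lex_ : ∀ {m} → (Fin m → Bool) → (Fin m → Bool) → Set
_≤lex_ {m} c d =
  (∀ i → c i ≡ d i) ⊎
  (Σ (Fin m) λ i → (∀ k → k < i → c k ≡ d k) × c i ≡ false × d i ≡ true)

column : ∀ {m n} → BoolMatrix m n → Fin n → (Fin m → Bool)
column BM j i = BM i j

ColumnsSorted : ∀ {m n} → BoolMatrix m n → Set
ColumnsSorted BM = ∀ j j' → j < j' → column BM j ≤lex column BM j'

IsBM : ∀ {m n} → BoolMatrix m n → Set
IsBM BM = RowsInLF BM × RowsDistinct BM × ColumnsSorted BM

IsLeft : ∀ {m n} → BoolMatrix m n → Fin m → Fin n → Set
IsLeft BM x l = BM x l ≡ true × (∀ j → j < l → BM x j ≡ false)

IsRight : ∀ {m n} → BoolMatrix m n → Fin m → Fin n → Set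
IsRight BM x r = BM x r ≡ true × (∀ j → r < j → BM x j ≡ false)

Overlaps : ∀ {m n} → BoolMatrix m n → Fin m → Fin m → Set
Overlaps BM y x =
  (∃ λ j → BM y j ≡ true × BM x j ≡ true) ×
  (∃ λ j → BM y j ≡ true × BM x j ≡ false) ×
  (∃ λ j → BM x j ≡ true × BM y j ≡ false)

-- Every 1 of row X lies in a column between left(X) and right(X), so its
-- column is squeezed between them in lexicographic order.  If the columns
-- left(X) and right(X) agreed on all rows up to r_Y, every column in between
-- would agree with them there as well, and row Y would be constant on X,
-- contradicting that Y overlaps X.  Hence they differ on some row t ≤ r_Y,
-- and by the lexicographic order the first difference is a 0 over a 1.
module Submission where

open import Defs
open import Data.Nat using (ℕ)
open import Data.Bool using (Bool; true; false)
open import Data.Fin using (Fin; _≤_; _<_)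
import Data.Fin.Properties as Fin
import Data.Nat.Properties as ℕ
open import Data.Product using (_×_; ∃; _,_; proj₁)
open import Data.Sum using (_⊎_; inj₁; inj₂)
open import Data.Empty using (⊥-elim)
open import Relation.Binary.PropositionalEquality using (_≡_; refl; sym; trans; module ≡-Reasoning)
open import Relation.Binary.Definitions using (tri<; tri≈; tri>)
open import Relation.Nullary using (¬_; yes; no)

private
  variable
    m n : ℕ

true≢false : ¬ true ≡ false
true≢false ()

AgreeUpTo : (c d : Fin m → Bool) → Fin m → Set
AgreeUpTo c d y = ∀ k → k ≤ y → c k ≡ d k

FirstDifferenceAt : (c d : Fin m → Bool) → Fin m → Set
FirstDifferenceAt c d i = (∀ k → k < i → c k ≡ d k) × c i ≡ false × d i ≡ true

≤lex-prefix : {c d : Fin m → Bool} → c ≤lex d → ∀ y →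
  AgreeUpTo c d y ⊎ ∃ λ i → i ≤ y × FirstDifferenceAt c d i
≤lex-prefix (inj₁ c≡d) y = inj₁ (λ k _ → c≡d k)
≤lex-prefix (inj₂ (i , diff@(c≡d , _))) y with i Fin.≤? y
... | yes i≤y = inj₂ (i , i≤y , diff)
... | no  i≰y = inj₁ (λ k k≤y → c≡d k (ℕ.≤-<-trans k≤y (ℕ.≰⇒> i≰y)))

≤lex-squeeze : {a c b : Fin m → Bool} → a ≤lex c → c ≤lex b →
  ∀ y → AgreeUpTo a b y → c y ≡ a y
≤lex-squeeze {a = a} {c} {b} a≤c c≤b y a≈b with ≤lex-prefix a≤c y
... | inj₁ a≈c = sym (a≈c y Fin.≤-refl)
... | inj₂ (i , i≤y , a≡c , ai , ci) with ≤lex-prefix c≤b i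
...   | inj₁ c≈b = ⊥-elim (true≢false (begin
          true  ≡⟨ sym ci ⟩
          c i   ≡⟨ c≈b i Fin.≤-refl ⟩
          b i   ≡⟨ sym (a≈b i i≤y) ⟩
          a i   ≡⟨ ai ⟩
          false ∎))
  where open ≡-Reasoning
...   | inj₂ (t , t≤i , _ , ct , bt) = ⊥-elim (true≢false (begin
          true  ≡⟨ sym bt ⟩
          b t   ≡⟨ sym (a≈b t (Fin.≤-trans t≤i i≤y)) ⟩
          a t   ≡⟨ a≡c t t<i ⟩
          c t   ≡⟨ ct ⟩
          false ∎))
  where
  open ≡-Reasoning
  t<i : t < i
  t<i = Fin.≤∧≢⇒< t≤i (λ { refl → true≢false (trans (sym ci) ct) })

sorted⇒≤lex : (BM : BoolMatrix m n) → ColumnsSorted BM →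
  ∀ {j j'} → j ≤ j' → column BM j ≤lex column BM j'
sorted⇒≤lex BM sorted {j} {j'} j≤j' with Fin.<-cmp j j'
... | tri< j<j' _ _ = sorted j j' j<j'
... | tri≈ _ refl _ = inj₁ (λ _ → refl)
... | tri> _ _ j'<j = ⊥-elim (ℕ.<⇒≱ j'<j j≤j')

left≤ : (BM : BoolMatrix m n) {x : Fin m} {l j : Fin n} →
  IsLeft BM x l → BM x j ≡ true → l ≤ j
left≤ BM (_ , before-l) xj = ℕ.≮⇒≥ (λ j<l → true≢false (trans (sym xj) (before-l _ j<l)))

≤right : (BM : BoolMatrix m n) {x : Fin m} {r j : Fin n} →
  IsRight BM x r → BM x j ≡ true → j ≤ r
≤right BM (_ , after-r) xj = ℕ.≮⇒≥ (λ r<j → true≢false (trans (sym xj) (after-r _ r<j)))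

constant-on-row : (BM : BoolMatrix m n) → ColumnsSorted BM →
  {x : Fin m} {l r : Fin n} → IsLeft BM x l → IsRight BM x r →
  ∀ y → AgreeUpTo (column BM l) (column BM r) y →
  ∀ {j} → BM x j ≡ true → BM y j ≡ BM y l
constant-on-row BM sorted left right y l≈r xj =
  ≤lex-squeeze (sorted⇒≤lex BM sorted (left≤ BM left xj))
               (sorted⇒≤lex BM sorted (≤right BM right xj)) y l≈r

lemma4 : ∀ {m n} (BM : BoolMatrix m n) → IsBM BM →
    (x y : Fin m) → Overlaps BM y x →
    (l r : Fin n) → IsLeft BM x l → IsRight BM x r →
    ∃ λ t → t ≤ y × BM t l ≡ false × BM t r ≡ true
lemma4 BM (_ , _ , sorted) x y ((j₁ , yj₁ , xj₁) , _ , (j₂ , xj₂ , yj₂)) l r left right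
  with ≤lex-prefix (sorted⇒≤lex BM sorted (≤right BM right (proj₁ left))) y
... | inj₂ (t , t≤y , _ , lt , rt) = t , t≤y , lt , rt
... | inj₁ l≈r = ⊥-elim (true≢false (begin
        true    ≡⟨ sym yj₁ ⟩
        BM y j₁ ≡⟨ row-constant xj₁ ⟩
        BM y l  ≡⟨ sym (row-constant xj₂) ⟩
        BM y j₂ ≡⟨ yj₂ ⟩
        false   ∎))
  where
  open ≡-Reasoning
  row-constant : ∀ {j} → BM x j ≡ true → BM y j ≡ BM y l
  row-constant = constant-on-row BM sorted left right y l≈r
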